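{- (1) For all $x : B$, if $P\,x = \texttt{true}$ and $\texttt{infinite\_dyn}\ x$, then $\texttt{infinite\_dyn}\ (g\,x)$. (2) For all $x : B$, if $P\,x = \texttt{false}$ and $\texttt{infinite\_dyn}\ x$, then $\texttt{infinite\_dyn}\ (g'\,x)$.
   Context: Work in Coq. Sets $A, B$; $P : B \to \texttt{bool}$; $h : B \to A$; $g, g' : B \to B$. \texttt{Inductive eventually\_dyn : B -> Prop := | ev\_dyn1 : forall x, P x = true -> eventually\_dyn x | ev\_dyn2 : forall x, P x = false -> eventually\_dyn (g' x) -> eventually\_dyn x.} \texttt{pre\_dyn : forall x, eventually\_dyn x -> A * B} is defined by structural recursion on the proof argument: \texttt{pre\_dyn x d} $= (h\,x, g\,x)$ if $P\,x = \texttt{true}$, and \texttt{pre\_dyn (g' x) d'} if $P\,x = \texttt{false}$, where \texttt{d'} is the structurally smaller sub-proof of \texttt{eventually\_dyn (g' x)} obtained by inversion of \texttt{d}. \texttt{CoInductive infinite\_dyn : B -> Prop := di : forall x (d : eventually\_dyn x), infinite\_dyn (snd (pre\_dyn x d)) -> infinite\_dyn x.} -}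

module Defs where

open import Data.Bool using (Bool; true; false)
open import Data.Product using (_×_; _,_; proj₂)
open import Relation.Binary.PropositionalEquality using (_≡_)

module Dyn {a b : _} (A : Set a) (B : Set b) (P : B → Bool) (h : B → A) (g g' : B → B) where

  data eventually-dyn : B → Set b where
    ev-dyn1 : ∀ x → P x ≡ true → eventually-dyn x
    ev-dyn2 : ∀ x → P x ≡ false → eventually-dyn (g' x) → eventually-dyn x

  pre-dyn : ∀ x → eventually-dyn x → A × B
  pre-dyn x (ev-dyn1 .x _) = h x , g x
  pre-dyn x (ev-dyn2 .x _ d') = pre-dyn (g' x) d'

  record infinite-dyn (x : B) : Set b where
    coinductive
    constructor di
    field
      d    : eventually-dyn x
      next : infinite-dyn (proj₂ (pre-dyn x d))

module Submission where

-- An infinite orbit `infinite-dyn x` consists of a proof `d` that the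
-- dynamics started at x eventually reaches a point where P holds, together
-- with an infinite orbit from the point `proj₂ (pre-dyn x d)` reached there.
-- Both parts of the theorem follow by inverting `d` once:
--   * if P x ≡ true, `d` must be `ev-dyn1`, so `pre-dyn x d` is (h x , g x)
--     and the stored continuation is already an infinite orbit from g x;
--   * if P x ≡ false, `d` must be `ev-dyn2 x _ d'` with `d'` a proof for g' x,
--     and `pre-dyn x d` unfolds to `pre-dyn (g' x) d'`, so `d'` together with
--     the stored continuation is an infinite orbit from g' x.

open import Defs
open import Data.Bool using (Bool; true; false)
open import Data.Product using (_×_; _,_; proj₂; Σ-syntax)
open import Relation.Binary.PropositionalEquality using (_≡_; refl; trans; sym; cong; subst)

module _ {a b} (A : Set a) (B : Set b) (P : B → Bool) (h : B → A) (g g' : B → B) where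
  open Dyn A B P h g g'
  open infinite-dyn

  true≢false : true ≡ false → ∀ {ℓ} {X : Set ℓ} → X
  true≢false ()

  pre-dyn-true : ∀ x → P x ≡ true → (e : eventually-dyn x) → pre-dyn x e ≡ (h x , g x)
  pre-dyn-true x _  (ev-dyn1 .x _)    = refl
  pre-dyn-true x px (ev-dyn2 .x pf _) = true≢false (trans (sym px) pf)

  pre-dyn-false : ∀ x → P x ≡ false → (e : eventually-dyn x) →
                  Σ[ e' ∈ eventually-dyn (g' x) ] pre-dyn x e ≡ pre-dyn (g' x) e'
  pre-dyn-false x px (ev-dyn1 .x pt)   = true≢false (trans (sym pt) px)
  pre-dyn-false x _  (ev-dyn2 .x _ e') = e' , refl

  infinite-after-stop : ∀ x → P x ≡ true → infinite-dyn x → infinite-dyn (g x)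
  infinite-after-stop x px orbit =
    subst infinite-dyn (cong proj₂ (pre-dyn-true x px (d orbit))) (next orbit)

  infinite-after-step : ∀ x → P x ≡ false → infinite-dyn x → infinite-dyn (g' x)
  infinite-after-step x px orbit with pre-dyn-false x px (d orbit)
  ... | e' , unfold = di e' (subst (λ p → infinite-dyn (proj₂ p)) unfold (next orbit))

lemma7p3 : ∀ {a b} (A : Set a) (B : Set b) (P : B → Bool) (h : B → A) (g g' : B → B) →
    ((x : B) → P x ≡ true → Dyn.infinite-dyn A B P h g g' x → Dyn.infinite-dyn A B P h g g' (g x))
    × ((x : B) → P x ≡ false → Dyn.infinite-dyn A B P h g g' x → Dyn.infinite-dyn A B P h g g' (g' x))
lemma7p3 A B P h g g' = infinite-after-stop A B P h g g' , infinite-after-step A B P h g g'
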